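{- If $G$ is a graph with $n$ vertices and $m\ge 12n$ edges, then $G$ has at least $\frac{m^3}{16n^2}$ paths of length three.
   Context: A path of length three is a sequence of four distinct vertices $v_1,v_2,v_3,v_4$ with $v_iv_{i+1}$ an edge for $i=1,2,3$. -}

module Defs where

open import Data.Nat using (ℕ; _<_; _<?_)
open import Data.Fin using (Fin)
open import Data.Fin.Properties using (_≟_)
open import Data.Fin.Subset using (Subset; ∣_∣)
open import Data.Fin.Subset.Properties using ()
open import Data.List using (List; length; filter; allFin; cartesianProduct)
open import Data.List using (concatMap; map) renaming ([_] to [_]ˡ)
open import Data.Product using (_×_; _,_)
open import Data.Bool using (Bool; true; false)
open import Relation.Nullary using (¬_; Dec)
open import Relation.Nullary.Decidable using (_×-dec_; ¬?)
open import Relation.Binary.PropositionalEquality using (_≡_)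
open import Data.Fin using (toℕ)

record Graph (n : ℕ) : Set₁ where
  field
    Adj     : Fin n → Fin n → Set
    adj?    : ∀ u v → Dec (Adj u v)
    sym     : ∀ {u v} → Adj u v → Adj v u
    irrefl  : ∀ {u} → ¬ Adj u u

module _ {n : ℕ} (G : Graph n) where
  open Graph G

  pairs : List (Fin n × Fin n)
  pairs = cartesianProduct (allFin n) (allFin n)

  edgeCount : ℕ
  edgeCount = length (filter (λ { (u , v) → (toℕ u <? toℕ v) ×-dec adj? u v }) pairs)

  quads : List (Fin n × Fin n × Fin n × Fin n)
  quads = concatMap (λ { (a , b) → map (λ { (c , d) → (a , b , c , d) }) pairs }) pairs

  distinct4? : (q : Fin n × Fin n × Fin n × Fin n) → Dec _
  distinct4? (a , b , c , d) =
    ¬? (a ≟ b) ×-dec ¬? (a ≟ c) ×-dec ¬? (a ≟ d) ×-dec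
    ¬? (b ≟ c) ×-dec ¬? (b ≟ d) ×-dec ¬? (c ≟ d)

  -- sequences v1 v2 v3 v4 of distinct vertices with consecutive vertices adjacent,
  -- normalised by toℕ v1 < toℕ v4 so that a path and its reversal are counted once
  isPath3? : (q : Fin n × Fin n × Fin n × Fin n) → Dec _
  isPath3? q@(a , b , c , d) =
    distinct4? q ×-dec adj? a b ×-dec adj? b c ×-dec adj? c d ×-dec (toℕ a <? toℕ d)

  path3Count : ℕ
  path3Count = length (filter isPath3? quads)

-- Let d = ⌊m / 2n⌋, so d ≥ 6 and 2nd ≤ m < 2n(d + 1). Deleting, one at a time, vertices of
-- degree at most d destroys at most nd ≤ m / 2 edges, so it leaves an induced subgraph H with
-- at least m ordered adjacent pairs and minimum degree greater than d. Every ordered adjacent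
-- pair (b, c) of H extends to at least d(d − 1) sequences a b c x of distinct vertices forming
-- a path (a ranges over the neighbours of b other than c, x over those of c other than a, b),
-- and each path of length three is read in this way in at most two directions. So twice the
-- number P of paths is at least m d(d − 1), and m² < 4n²(d + 1)² ≤ 8n² d(d − 1) gives
-- m³ ≤ 16 n² P.
module Submission where

open import Level using (Level)
open import Data.Bool using (true; false; if_then_else_)
open import Data.Nat using (ℕ; NonZero; zero; suc; _+_; _*_; _^_; _∸_; _≤_; _<_; z≤n; s≤s; _≤?_; _<?_)
open import Data.Nat.Properties hiding (_≟_)
open import Data.Nat.DivMod using (_/_; _%_; m≡m%n+[m/n]*n; m%n<n; m/n*n≤m; m*n/n≡m; /-monoˡ-≤)
open import Data.Nat.Induction using (<-wellFounded)
open import Data.Nat.ListAction using () renaming (sum to sumˡ)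
open import Data.Nat.ListAction.Properties using (sum-++)
open import Data.Nat.Tactic.RingSolver using (solve-∀)
open import Data.Fin using (Fin; toℕ)
open import Data.Fin.Properties using (_≟_; any?; toℕ-injective)
open import Data.Fin.Subset using (Subset; _∈_; _-_; ⊤; ∣_∣)
open import Data.Fin.Subset.Properties using (_∈?_; ∈⊤; x∈p∧x≢y⇒x∈p-y; x∈p⇒∣p-x∣<∣p∣; ∣⊤∣≡n)
open import Data.List using (List; []; _∷_; _++_; length; filter; map; tabulate; allFin; concatMap; cartesianProduct)
open import Data.List.Properties using (map-++; map-tabulate; map-∘; map-cong)
open import Data.Product using (∃-syntax; _×_; _,_)
open import Data.Sum using (_⊎_; inj₁; inj₂)
open import Data.Empty using (⊥-elim)
open import Function using (_∘_; id; _on_)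
open import Induction.WellFounded using (Acc; acc)
open import Relation.Nullary using (¬_; Dec; yes; no; does)
open import Relation.Nullary.Decidable using (_×-dec_; _⊎-dec_; ¬?)
open import Relation.Unary using (Pred; Decidable)
open import Relation.Binary.PropositionalEquality
import Relation.Binary.Construct.On as On
open import Algebra.Properties.Semiring.Sum +-*-semiring
  using (sum-syntax; sum-replicate-zero; sum-cong-≗; ∑-distrib-+; ∑-comm; *-distribˡ-sum; *-distribʳ-sum)

open import Defs

private variable
  a b : Level
  P Q R : Set a
  n : ℕ

-- Defined through `does`, so that it computes through `Dec.map′` (as in `suc i ≟ suc v`).
𝟙 : Dec P → ℕ
𝟙 p = if does p then 1 else 0

𝟙-mono : (p : Dec P) (q : Dec Q) → (P → Q) → 𝟙 p ≤ 𝟙 q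
𝟙-mono (yes _) (yes _) f = ≤-refl
𝟙-mono (yes x) (no ¬y) f = ⊥-elim (¬y (f x))
𝟙-mono (no _)  q       f = z≤n

𝟙-× : (p : Dec P) (q : Dec Q) → 𝟙 (p ×-dec q) ≡ 𝟙 p * 𝟙 q
𝟙-× (yes _) (yes _) = refl
𝟙-× (yes _) (no _)  = refl
𝟙-× (no _)  _       = refl

𝟙-≤-+ : (p : Dec P) (q : Dec Q) (r : Dec R) → (P → Q ⊎ R) → 𝟙 p ≤ 𝟙 q + 𝟙 r
𝟙-≤-+ (no _)  q r f = z≤n
𝟙-≤-+ (yes x) q r f with f x
... | inj₁ y = ≤-trans (𝟙-mono (yes y) q id) (m≤m+n (𝟙 q) (𝟙 r))
... | inj₂ z = ≤-trans (𝟙-mono (yes z) r id) (m≤n+m (𝟙 r) (𝟙 q))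

𝟙-+-≤ : (p : Dec P) (q : Dec Q) (r : Dec R) → (P → R) → (Q → R) → (P → ¬ Q) → 𝟙 p + 𝟙 q ≤ 𝟙 r
𝟙-+-≤ (yes x) (yes y) r f g h = ⊥-elim (h x y)
𝟙-+-≤ (yes x) (no _)  r f g h = 𝟙-mono (yes x) r f
𝟙-+-≤ (no _)  q       r f g h = 𝟙-mono q r g

𝟙*-monoʳ-≤ : (p : Dec P) {x y : ℕ} → (P → x ≤ y) → 𝟙 p * x ≤ 𝟙 p * y
𝟙*-monoʳ-≤ (yes x) f = *-monoʳ-≤ 1 (f x)
𝟙*-monoʳ-≤ (no _)  f = z≤n

𝟙*-≤ : (p : Dec P) {x y : ℕ} → (P → x ≤ y) → 𝟙 p * x ≤ y
𝟙*-≤ (yes p) {x} f = ≤-trans (≤-reflexive (+-identityʳ x)) (f p)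
𝟙*-≤ (no _)      f = z≤n

∑-mono-≤ : {f g : Fin n → ℕ} → (∀ i → f i ≤ g i) → ∑[ i < n ] f i ≤ ∑[ i < n ] g i
∑-mono-≤ {zero}  f≤g = z≤n
∑-mono-≤ {suc n} f≤g = +-mono-≤ (f≤g Fin.zero) (∑-mono-≤ (f≤g ∘ Fin.suc))

∑-𝟙≟-* : (v : Fin n) (f : Fin n → ℕ) → ∑[ i < n ] (𝟙 (i ≟ v) * f i) ≡ f v
∑-𝟙≟-* {suc n} Fin.zero f =
  trans (cong (f Fin.zero + 0 +_) (sum-replicate-zero n)) (trans (+-identityʳ _) (+-identityʳ _))
∑-𝟙≟-* {suc n} (Fin.suc v) f = ∑-𝟙≟-* v (f ∘ Fin.suc)

count : {P : Pred (Fin n) a} → Decidable P → ℕ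
count {n = n} P? = ∑[ i < n ] 𝟙 (P? i)

count-≢ : {P : Pred (Fin n) a} (P? : Decidable P) (w : Fin n) →
          count P? ≤ suc (count (λ i → P? i ×-dec ¬? (i ≟ w)))
count-≢ {n = n} {P = P} P? w = begin
  count P?                                 ≤⟨ ∑-mono-≤ (λ i → 𝟙-≤-+ (P? i) (P?′ i) (i ≟ w) (split i)) ⟩
  ∑[ i < n ] (𝟙 (P?′ i) + 𝟙 (i ≟ w))       ≡⟨ ∑-distrib-+ (λ i → 𝟙 (P?′ i)) (λ i → 𝟙 (i ≟ w)) ⟩
  count P?′ + ∑[ i < n ] 𝟙 (i ≟ w)         ≡⟨ cong (count P?′ +_) ∑-𝟙≟ ⟩
  count P?′ + 1                            ≡⟨ +-comm _ 1 ⟩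
  suc (count P?′)                          ∎
  where
  open ≤-Reasoning
  P?′ : Decidable (λ i → P i × i ≢ w)
  P?′ i = P? i ×-dec ¬? (i ≟ w)
  split : ∀ i → P i → (P i × i ≢ w) ⊎ i ≡ w
  split i p with i ≟ w
  ... | yes i≡w = inj₂ i≡w
  ... | no  i≢w = inj₁ (p , i≢w)
  ∑-𝟙≟ : ∑[ i < n ] 𝟙 (i ≟ w) ≡ 1
  ∑-𝟙≟ = trans (sum-cong-≗ (λ i → sym (*-identityʳ (𝟙 (i ≟ w))))) (∑-𝟙≟-* w (λ _ → 1))

count*≤∑ : {P : Pred (Fin n) a} (P? : Decidable P) {e : ℕ} (f : Fin n → ℕ) →
           (∀ i → P i → e ≤ f i) → count P? * e ≤ ∑[ i < n ] (𝟙 (P? i) * f i)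
count*≤∑ {n = n} P? {e} f e≤f = begin
  count P? * e                 ≡⟨ *-distribʳ-sum {n} e (λ i → 𝟙 (P? i)) ⟩
  ∑[ i < n ] (𝟙 (P? i) * e)    ≤⟨ ∑-mono-≤ (λ i → 𝟙*-monoʳ-≤ (P? i) (e≤f i)) ⟩
  ∑[ i < n ] (𝟙 (P? i) * f i)  ∎
  where open ≤-Reasoning

∑²-distrib-+ : ∀ {m n} (f g : Fin m → Fin n → ℕ) →
  ∑[ i < m ] ∑[ j < n ] (f i j + g i j) ≡ ∑[ i < m ] ∑[ j < n ] f i j + ∑[ i < m ] ∑[ j < n ] g i j
∑²-distrib-+ {m} {n} f g = trans (sum-cong-≗ (λ i → ∑-distrib-+ {n} (f i) (g i)))
                                 (∑-distrib-+ {m} (λ i → ∑[ j < n ] f i j) (λ i → ∑[ j < n ] g i j))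

∑⁴ : (Fin n → Fin n → Fin n → Fin n → ℕ) → ℕ
∑⁴ {n} f = ∑[ a < n ] ∑[ b < n ] ∑[ c < n ] ∑[ d < n ] f a b c d

∑⁴-mono-≤ : {f g : Fin n → Fin n → Fin n → Fin n → ℕ} →
            (∀ a b c d → f a b c d ≤ g a b c d) → ∑⁴ f ≤ ∑⁴ g
∑⁴-mono-≤ f≤g = ∑-mono-≤ λ a → ∑-mono-≤ λ b → ∑-mono-≤ λ c → ∑-mono-≤ λ d → f≤g a b c d

∑⁴-distrib-+ : (f g : Fin n → Fin n → Fin n → Fin n → ℕ) →
               ∑⁴ (λ a b c d → f a b c d + g a b c d) ≡ ∑⁴ f + ∑⁴ g
∑⁴-distrib-+ {n} f g =
  trans (sum-cong-≗ λ a → sum-cong-≗ λ b → ∑²-distrib-+ (f a b) (g a b))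
        (∑²-distrib-+ (λ a b → ∑[ c < n ] ∑[ d < n ] f a b c d) (λ a b → ∑[ c < n ] ∑[ d < n ] g a b c d))

∑⁴-reverse : (f : Fin n → Fin n → Fin n → Fin n → ℕ) → ∑⁴ f ≡ ∑⁴ (λ a b c d → f d c b a)
∑⁴-reverse {n} f = begin
  ∑[ a < n ] ∑[ b < n ] ∑[ c < n ] ∑[ d < n ] f a b c d ≡⟨ sum-cong-≗ (λ a → sum-cong-≗ λ b → ∑-comm (f a b)) ⟩
  ∑[ a < n ] ∑[ b < n ] ∑[ d < n ] ∑[ c < n ] f a b c d ≡⟨ sum-cong-≗ (λ a → ∑-comm λ b d → ∑[ c < n ] f a b c d) ⟩
  ∑[ a < n ] ∑[ d < n ] ∑[ b < n ] ∑[ c < n ] f a b c d ≡⟨ ∑-comm (λ a d → ∑[ b < n ] ∑[ c < n ] f a b c d) ⟩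
  ∑[ d < n ] ∑[ a < n ] ∑[ b < n ] ∑[ c < n ] f a b c d ≡⟨ sum-cong-≗ (λ d → sum-cong-≗ λ a → ∑-comm λ b c → f a b c d) ⟩
  ∑[ d < n ] ∑[ a < n ] ∑[ c < n ] ∑[ b < n ] f a b c d ≡⟨ sum-cong-≗ (λ d → ∑-comm λ a c → ∑[ b < n ] f a b c d) ⟩
  ∑[ d < n ] ∑[ c < n ] ∑[ a < n ] ∑[ b < n ] f a b c d ≡⟨ sum-cong-≗ (λ d → sum-cong-≗ λ c → ∑-comm λ a b → f a b c d) ⟩
  ∑[ d < n ] ∑[ c < n ] ∑[ b < n ] ∑[ a < n ] f a b c d ∎
  where open ≡-Reasoning

sumˡ-tabulate : (f : Fin n → ℕ) → sumˡ (tabulate f) ≡ ∑[ i < n ] f i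
sumˡ-tabulate {zero}  f = refl
sumˡ-tabulate {suc n} f = cong (f Fin.zero +_) (sumˡ-tabulate (f ∘ Fin.suc))

sumˡ-map-allFin : (f : Fin n → ℕ) → sumˡ (map f (allFin n)) ≡ ∑[ i < n ] f i
sumˡ-map-allFin f = trans (cong sumˡ (map-tabulate id f)) (sumˡ-tabulate f)

module _ {A : Set a} where

  length-filter : {P : Pred A b} (P? : Decidable P) (xs : List A) →
                  length (filter P? xs) ≡ sumˡ (map (𝟙 ∘ P?) xs)
  length-filter P? []       = refl
  length-filter P? (x ∷ xs) with does (P? x)
  ... | true  = cong suc (length-filter P? xs)
  ... | false = length-filter P? xs

  sumˡ-map-++ : (k : A → ℕ) (xs ys : List A) → sumˡ (map k (xs ++ ys)) ≡ sumˡ (map k xs) + sumˡ (map k ys)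
  sumˡ-map-++ k xs ys = trans (cong sumˡ (map-++ k xs ys)) (sum-++ (map k xs) (map k ys))

module _ {A : Set a} {B : Set b} where

  sumˡ-map-concatMap : (k : B → ℕ) (h : A → List B) (xs : List A) →
    sumˡ (map k (concatMap h xs)) ≡ sumˡ (map (λ x → sumˡ (map k (h x))) xs)
  sumˡ-map-concatMap k h []       = refl
  sumˡ-map-concatMap k h (x ∷ xs) =
    trans (sumˡ-map-++ k (h x) (concatMap h xs)) (cong (sumˡ (map k (h x)) +_) (sumˡ-map-concatMap k h xs))

  sumˡ-map-cartesianProduct : (k : A × B → ℕ) (xs : List A) (ys : List B) →
    sumˡ (map k (cartesianProduct xs ys)) ≡ sumˡ (map (λ x → sumˡ (map (λ y → k (x , y)) ys)) xs)
  sumˡ-map-cartesianProduct k []       ys = refl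
  sumˡ-map-cartesianProduct k (x ∷ xs) ys =
    trans (sumˡ-map-++ k (map (x ,_) ys) (cartesianProduct xs ys))
          (cong₂ _+_ (cong sumˡ (sym (map-∘ ys))) (sumˡ-map-cartesianProduct k xs ys))

module _ {n : ℕ} (G : Graph n) where
  open Graph G renaming (sym to adj-sym)

  sumˡ-map-pairs : (k : Fin n × Fin n → ℕ) → sumˡ (map k (pairs G)) ≡ ∑[ u < n ] ∑[ v < n ] k (u , v)
  sumˡ-map-pairs k = trans (sumˡ-map-cartesianProduct k (allFin n) (allFin n))
    (trans (cong sumˡ (map-cong (λ u → sumˡ-map-allFin (λ v → k (u , v))) (allFin n)))
           (sumˡ-map-allFin (λ u → ∑[ v < n ] k (u , v))))

  edgeCount≡∑² : edgeCount G ≡ ∑[ u < n ] ∑[ v < n ] 𝟙 ((toℕ u <? toℕ v) ×-dec adj? u v)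
  edgeCount≡∑² = trans (length-filter _ (pairs G)) (sumˡ-map-pairs _)

  path3Count≡∑⁴ : path3Count G ≡ ∑⁴ λ a b c d → 𝟙 (isPath3? G (a , b , c , d))
  path3Count≡∑⁴ = trans (length-filter (isPath3? G) (quads G))
    (trans (sumˡ-map-concatMap (𝟙 ∘ isPath3? G) _ (pairs G))
    (trans (sumˡ-map-pairs _)
           (sum-cong-≗ λ a → sum-cong-≗ λ b →
              trans (cong sumˡ (sym (map-∘ {g = 𝟙 ∘ isPath3? G} {f = λ (c , d) → (a , b , c , d)} (pairs G))))
                    (sumˡ-map-pairs λ (c , d) → 𝟙 (isPath3? G (a , b , c , d))))))

  adj⇒≢ : ∀ {u v} → Adj u v → u ≢ v
  adj⇒≢ uv refl = irrefl uv

  degreeIn : Subset n → Fin n → ℕ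
  degreeIn S v = count (λ u → u ∈? S ×-dec adj? v u)

  arc? : (S : Subset n) (u v : Fin n) → Dec (u ∈ S × v ∈ S × Adj u v)
  arc? S u v = u ∈? S ×-dec v ∈? S ×-dec adj? u v

  arcCount : Subset n → ℕ
  arcCount S = ∑[ u < n ] ∑[ v < n ] 𝟙 (arc? S u v)

  edgeCount+edgeCount≤arcCount⊤ : edgeCount G + edgeCount G ≤ arcCount ⊤
  edgeCount+edgeCount≤arcCount⊤ = begin
    edgeCount G + edgeCount G
      ≡⟨ cong₂ _+_ edgeCount≡∑² (trans edgeCount≡∑² (∑-comm E)) ⟩
    ∑[ u < n ] ∑[ v < n ] E u v + ∑[ u < n ] ∑[ v < n ] E v u
      ≡⟨ ∑²-distrib-+ E (λ u v → E v u) ⟨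
    ∑[ u < n ] ∑[ v < n ] (E u v + E v u)
      ≤⟨ ∑-mono-≤ (λ u → ∑-mono-≤ λ v →
           𝟙-+-≤ (E? u v) (E? v u) (arc? ⊤ u v)
                 (λ (_ , uv) → ∈⊤ , ∈⊤ , uv) (λ (_ , vu) → ∈⊤ , ∈⊤ , adj-sym vu)
                 (λ (u<v , _) (v<u , _) → <-asym u<v v<u)) ⟩
    arcCount ⊤ ∎
    where
    open ≤-Reasoning
    E? : (u v : Fin n) → Dec (toℕ u < toℕ v × Adj u v)
    E? u v = (toℕ u <? toℕ v) ×-dec adj? u v
    E : Fin n → Fin n → ℕ
    E u v = 𝟙 (E? u v)

  arcCount-remove : (S : Subset n) (v : Fin n) → arcCount S ≤ arcCount (S - v) + 2 * degreeIn S v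
  arcCount-remove S v = begin
    arcCount S
      ≤⟨ ∑-mono-≤ (λ b → ∑-mono-≤ λ c → split b c) ⟩
    ∑[ b < n ] ∑[ c < n ] (𝟙 (arc? (S - v) b c) + (𝟙 (from? b c) + 𝟙 (to? b c)))
      ≡⟨ ∑²-distrib-+ (λ b c → 𝟙 (arc? (S - v) b c)) (λ b c → 𝟙 (from? b c) + 𝟙 (to? b c)) ⟩
    arcCount (S - v) + ∑[ b < n ] ∑[ c < n ] (𝟙 (from? b c) + 𝟙 (to? b c))
      ≡⟨ cong (arcCount (S - v) +_) (∑²-distrib-+ (λ b c → 𝟙 (from? b c)) (λ b c → 𝟙 (to? b c))) ⟩
    arcCount (S - v) + (∑[ b < n ] ∑[ c < n ] 𝟙 (from? b c) + ∑[ b < n ] ∑[ c < n ] 𝟙 (to? b c))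
      ≡⟨ cong (arcCount (S - v) +_) (cong₂ _+_ arcs-from-v arcs-to-v) ⟩
    arcCount (S - v) + (degreeIn S v + degreeIn S v)
      ≡⟨ cong (λ x → arcCount (S - v) + (degreeIn S v + x)) (+-identityʳ (degreeIn S v)) ⟨
    arcCount (S - v) + 2 * degreeIn S v ∎
    where
    open ≤-Reasoning
    nbr? : (u : Fin n) → Dec (u ∈ S × Adj v u)
    nbr? u = u ∈? S ×-dec adj? v u
    from? : (b c : Fin n) → Dec (b ≡ v × c ∈ S × Adj v c)
    to?   : (b c : Fin n) → Dec (c ≡ v × b ∈ S × Adj v b)
    from? b c = (b ≟ v) ×-dec nbr? c
    to?   b c = (c ≟ v) ×-dec nbr? b

    classify : ∀ {b c} → b ∈ S × c ∈ S × Adj b c →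
               (b ∈ S - v × c ∈ S - v × Adj b c) ⊎ (b ≡ v × c ∈ S × Adj v c) ⊎ (c ≡ v × b ∈ S × Adj v b)
    classify {b} {c} (b∈S , c∈S , bc) with b ≟ v | c ≟ v
    ... | yes refl | _        = inj₂ (inj₁ (refl , c∈S , bc))
    ... | no  _    | yes refl = inj₂ (inj₂ (refl , b∈S , adj-sym bc))
    ... | no  b≢v  | no  c≢v  = inj₁ (x∈p∧x≢y⇒x∈p-y b∈S b≢v , x∈p∧x≢y⇒x∈p-y c∈S c≢v , bc)

    split : ∀ b c → 𝟙 (arc? S b c) ≤ 𝟙 (arc? (S - v) b c) + (𝟙 (from? b c) + 𝟙 (to? b c))
    split b c = ≤-trans (𝟙-≤-+ (arc? S b c) (arc? (S - v) b c) (from? b c ⊎-dec to? b c) classify)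
                        (+-monoʳ-≤ _ (𝟙-≤-+ (from? b c ⊎-dec to? b c) (from? b c) (to? b c) id))

    arcs-from-v : ∑[ b < n ] ∑[ c < n ] 𝟙 (from? b c) ≡ degreeIn S v
    arcs-from-v = begin-equality
      ∑[ b < n ] ∑[ c < n ] 𝟙 (from? b c)              ≡⟨ sum-cong-≗ (λ b → sum-cong-≗ λ c → 𝟙-× (b ≟ v) (nbr? c)) ⟩
      ∑[ b < n ] ∑[ c < n ] (𝟙 (b ≟ v) * 𝟙 (nbr? c))   ≡⟨ sum-cong-≗ (λ b → *-distribˡ-sum {n} (𝟙 (b ≟ v)) (𝟙 ∘ nbr?)) ⟨
      ∑[ b < n ] (𝟙 (b ≟ v) * degreeIn S v)            ≡⟨ ∑-𝟙≟-* v (λ _ → degreeIn S v) ⟩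
      degreeIn S v                                     ∎

    arcs-to-v : ∑[ b < n ] ∑[ c < n ] 𝟙 (to? b c) ≡ degreeIn S v
    arcs-to-v = sum-cong-≗ λ b → trans (sum-cong-≗ λ c → 𝟙-× (c ≟ v) (nbr? b)) (∑-𝟙≟-* v (λ _ → 𝟙 (nbr? b)))

  MinDegreeAbove : ℕ → Subset n → Set
  MinDegreeAbove d T = ∀ {v} → v ∈ T → d < degreeIn T v

  peel : (d : ℕ) (S : Subset n) →
         ∃[ T ] arcCount S ≤ arcCount T + ∣ S ∣ * (2 * d) × MinDegreeAbove d T
  peel d S = go S (On.wellFounded ∣_∣ <-wellFounded S)
    where
    go : ∀ S → Acc (_<_ on ∣_∣) S → ∃[ T ] arcCount S ≤ arcCount T + ∣ S ∣ * (2 * d) × MinDegreeAbove d T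
    go S (acc rs) with any? (λ v → v ∈? S ×-dec degreeIn S v ≤? d)
    ... | no ¬low = S , m≤m+n _ _ , λ v∈S → ≰⇒> λ deg≤d → ¬low (_ , v∈S , deg≤d)
    ... | yes (v , v∈S , deg≤d) with go (S - v) (rs (x∈p⇒∣p-x∣<∣p∣ v∈S))
    ... | T , bound , minDegT = T , bound′ , minDegT
      where
      open ≤-Reasoning
      bound′ : arcCount S ≤ arcCount T + ∣ S ∣ * (2 * d)
      bound′ = begin
        arcCount S                                              ≤⟨ arcCount-remove S v ⟩
        arcCount (S - v) + 2 * degreeIn S v                     ≤⟨ +-mono-≤ bound (*-monoʳ-≤ 2 deg≤d) ⟩
        arcCount T + ∣ S - v ∣ * (2 * d) + 2 * d                ≡⟨ +-assoc (arcCount T) _ _ ⟩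
        arcCount T + (∣ S - v ∣ * (2 * d) + 2 * d)              ≡⟨ cong (arcCount T +_) (+-comm _ (2 * d)) ⟩
        arcCount T + suc ∣ S - v ∣ * (2 * d)                    ≤⟨ +-monoʳ-≤ (arcCount T) (*-monoˡ-≤ (2 * d) (x∈p⇒∣p-x∣<∣p∣ v∈S)) ⟩
        arcCount T + ∣ S ∣ * (2 * d)                            ∎

  denseCore : (d : ℕ) → d * (2 * n) ≤ edgeCount G → ∃[ T ] edgeCount G ≤ arcCount T × MinDegreeAbove d T
  denseCore d 2nd≤m with peel d ⊤
  ... | T , arcs⊤≤ , minDeg = T , +-cancelʳ-≤ m m (arcCount T) m+m≤arcs+m , minDeg
    where
    m : ℕ
    m = edgeCount G
    open ≤-Reasoning
    swap : ∀ n d → n * (2 * d) ≡ d * (2 * n)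
    swap = solve-∀
    m+m≤arcs+m : m + m ≤ arcCount T + m
    m+m≤arcs+m = begin
      m + m                            ≤⟨ edgeCount+edgeCount≤arcCount⊤ ⟩
      arcCount ⊤                       ≤⟨ arcs⊤≤ ⟩
      arcCount T + ∣ ⊤ {n} ∣ * (2 * d) ≡⟨ cong (λ k → arcCount T + k * (2 * d)) (∣⊤∣≡n n) ⟩
      arcCount T + n * (2 * d)         ≡⟨ cong (arcCount T +_) (swap n d) ⟩
      arcCount T + d * (2 * n)         ≤⟨ +-monoʳ-≤ (arcCount T) 2nd≤m ⟩
      arcCount T + m                   ∎

  Distinct4 : (a b c d : Fin n) → Set
  Distinct4 a b c d = a ≢ b × a ≢ c × a ≢ d × b ≢ c × b ≢ d × c ≢ d

  OrderedPath3 : (a b c d : Fin n) → Set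
  OrderedPath3 a b c d = Distinct4 a b c d × Adj a b × Adj b c × Adj c d

  orderedPath3? : ∀ a b c d → Dec (OrderedPath3 a b c d)
  orderedPath3? a b c d = distinct4? G (a , b , c , d) ×-dec adj? a b ×-dec adj? b c ×-dec adj? c d

  orderedPath3Count : ℕ
  orderedPath3Count = ∑⁴ λ a b c d → 𝟙 (orderedPath3? a b c d)

  orient : ∀ {a b c d} → OrderedPath3 a b c d →
           (Distinct4 a b c d × Adj a b × Adj b c × Adj c d × toℕ a < toℕ d) ⊎
           (Distinct4 d c b a × Adj d c × Adj c b × Adj b a × toℕ d < toℕ a)
  orient {a} {b} {c} {d} (distinct@(a≢b , a≢c , a≢d , b≢c , b≢d , c≢d) , ab , bc , cd)
    with toℕ a <? toℕ d
  ... | yes a<d = inj₁ (distinct , ab , bc , cd , a<d)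
  ... | no  a≮d = inj₂ ((≢-sym c≢d , ≢-sym b≢d , ≢-sym a≢d , ≢-sym b≢c , ≢-sym a≢c , ≢-sym a≢b)
                       , adj-sym cd , adj-sym bc , adj-sym ab
                       , ≤∧≢⇒< (≮⇒≥ a≮d) (a≢d ∘ toℕ-injective ∘ sym))

  orderedPath3Count≤2*path3Count : orderedPath3Count ≤ 2 * path3Count G
  orderedPath3Count≤2*path3Count = begin
    orderedPath3Count
      ≤⟨ ∑⁴-mono-≤ (λ a b c d →
           𝟙-≤-+ (orderedPath3? a b c d) (isPath3? G (a , b , c , d)) (isPath3? G (d , c , b , a)) orient) ⟩
    ∑⁴ (λ a b c d → path a b c d + path d c b a) ≡⟨ ∑⁴-distrib-+ path (λ a b c d → path d c b a) ⟩
    ∑⁴ path + ∑⁴ (λ a b c d → path d c b a)     ≡⟨ cong (∑⁴ path +_) (∑⁴-reverse path) ⟨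
    ∑⁴ path + ∑⁴ path                           ≡⟨ cong (λ x → ∑⁴ path + x) (+-identityʳ (∑⁴ path)) ⟨
    2 * ∑⁴ path                                 ≡⟨ cong (2 *_) path3Count≡∑⁴ ⟨
    2 * path3Count G                            ∎
    where
    open ≤-Reasoning
    path : Fin n → Fin n → Fin n → Fin n → ℕ
    path a b c d = 𝟙 (isPath3? G (a , b , c , d))

  module _ {d : ℕ} {T : Subset n} (minDeg : MinDegreeAbove d T) where

    pathsThroughArc : ∀ {b c} → b ∈ T → c ∈ T → Adj b c →
                      d * (d ∸ 1) ≤ ∑[ a < n ] ∑[ x < n ] 𝟙 (orderedPath3? a b c x)
    pathsThroughArc {b} {c} b∈T c∈T bc = begin
      d * (d ∸ 1)
        ≤⟨ *-monoˡ-≤ (d ∸ 1) d≤#first ⟩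
      count first? * (d ∸ 1)
        ≤⟨ count*≤∑ first? (count ∘ last?) (λ a _ → d∸1≤#last a) ⟩
      ∑[ a < n ] (𝟙 (first? a) * count (last? a))
        ≡⟨ sum-cong-≗ (λ a → *-distribˡ-sum {n} (𝟙 (first? a)) (𝟙 ∘ last? a)) ⟩
      ∑[ a < n ] ∑[ x < n ] (𝟙 (first? a) * 𝟙 (last? a x))
        ≡⟨ sum-cong-≗ (λ a → sum-cong-≗ λ x → 𝟙-× (first? a) (last? a x)) ⟨
      ∑[ a < n ] ∑[ x < n ] 𝟙 (first? a ×-dec last? a x)
        ≤⟨ ∑-mono-≤ (λ a → ∑-mono-≤ λ x → 𝟙-mono (first? a ×-dec last? a x) (orderedPath3? a b c x) isPath) ⟩
      ∑[ a < n ] ∑[ x < n ] 𝟙 (orderedPath3? a b c x)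
        ∎
      where
      open ≤-Reasoning
      first? : (a : Fin n) → Dec ((a ∈ T × Adj b a) × a ≢ c)
      first? a = (a ∈? T ×-dec adj? b a) ×-dec ¬? (a ≟ c)
      last? : (a x : Fin n) → Dec (((x ∈ T × Adj c x) × x ≢ b) × x ≢ a)
      last? a x = ((x ∈? T ×-dec adj? c x) ×-dec ¬? (x ≟ b)) ×-dec ¬? (x ≟ a)

      d≤#first : d ≤ count first?
      d≤#first = ≤-pred (≤-trans (minDeg b∈T) (count-≢ (λ a → a ∈? T ×-dec adj? b a) c))

      d∸1≤#last : ∀ a → d ∸ 1 ≤ count (last? a)
      d∸1≤#last a = ∸-monoˡ-≤ 1 (≤-pred (begin
        suc d                        ≤⟨ minDeg c∈T ⟩
        degreeIn T c                 ≤⟨ count-≢ (λ x → x ∈? T ×-dec adj? c x) b ⟩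
        suc (count c-nbr-not-b?)     ≤⟨ s≤s (count-≢ c-nbr-not-b? a) ⟩
        suc (suc (count (last? a)))  ∎))
        where
        c-nbr-not-b? : (x : Fin n) → Dec ((x ∈ T × Adj c x) × x ≢ b)
        c-nbr-not-b? x = (x ∈? T ×-dec adj? c x) ×-dec ¬? (x ≟ b)

      isPath : ∀ {a x} → ((a ∈ T × Adj b a) × a ≢ c) × (((x ∈ T × Adj c x) × x ≢ b) × x ≢ a) →
               OrderedPath3 a b c x
      isPath (((_ , ba) , a≢c) , ((_ , cx) , x≢b) , x≢a) =
        (adj⇒≢ (adj-sym ba) , a≢c , ≢-sym x≢a , adj⇒≢ bc , ≢-sym x≢b , adj⇒≢ cx) , adj-sym ba , bc , cx

    arcCount*≤orderedPath3Count : arcCount T * (d * (d ∸ 1)) ≤ orderedPath3Count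
    arcCount*≤orderedPath3Count = begin
      arcCount T * K
        ≡⟨ *-distribʳ-sum {n} K (λ b → ∑[ c < n ] 𝟙 (arc? T b c)) ⟩
      ∑[ b < n ] ((∑[ c < n ] 𝟙 (arc? T b c)) * K)
        ≡⟨ sum-cong-≗ (λ b → *-distribʳ-sum {n} K (𝟙 ∘ arc? T b)) ⟩
      ∑[ b < n ] ∑[ c < n ] (𝟙 (arc? T b c) * K)
        ≤⟨ ∑-mono-≤ (λ b → ∑-mono-≤ λ c → 𝟙*-≤ (arc? T b c) λ (b∈T , c∈T , bc) → pathsThroughArc b∈T c∈T bc) ⟩
      ∑[ b < n ] ∑[ c < n ] ∑[ a < n ] ∑[ x < n ] W a b c x
        ≡⟨ sum-cong-≗ (λ b → ∑-comm λ c a → ∑[ x < n ] W a b c x) ⟩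
      ∑[ b < n ] ∑[ a < n ] ∑[ c < n ] ∑[ x < n ] W a b c x
        ≡⟨ ∑-comm (λ b a → ∑[ c < n ] ∑[ x < n ] W a b c x) ⟩
      orderedPath3Count
        ∎
      where
      open ≤-Reasoning
      K : ℕ
      K = d * (d ∸ 1)
      W : Fin n → Fin n → Fin n → Fin n → ℕ
      W a b c x = 𝟙 (orderedPath3? a b c x)

m<[1+m/n]*n : ∀ m n .{{_ : NonZero n}} → m < suc (m / n) * n
m<[1+m/n]*n m n = begin-strict
  m                 ≡⟨ m≡m%n+[m/n]*n m n ⟩
  m % n + m / n * n <⟨ +-monoˡ-< (m / n * n) (m%n<n m n) ⟩
  n + m / n * n     ∎
  where open ≤-Reasoning

square-bound : ∀ n d m → 6 ≤ d → m ≤ suc d * (2 * n) → m * m ≤ 8 * n ^ 2 * (d * (d ∸ 1))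
square-bound n d m 6≤d m≤ with m≤n⇒∃[o]m+o≡n 6≤d
... | t , refl = begin
  m * m                                                       ≤⟨ *-mono-≤ m≤ m≤ ⟩
  (7 + t) * (2 * n) * ((7 + t) * (2 * n))                     ≤⟨ m≤m+n _ _ ⟩
  (7 + t) * (2 * n) * ((7 + t) * (2 * n)) + 4 * n ^ 2 * (11 + 8 * t + t * t) ≡⟨ identity n t ⟩
  8 * n ^ 2 * ((6 + t) * (5 + t))                             ∎
  where
  open ≤-Reasoning
  identity : ∀ n t → (7 + t) * (2 * n) * ((7 + t) * (2 * n)) + 4 * (n * (n * 1)) * (11 + 8 * t + t * t)
                   ≡ 8 * (n * (n * 1)) * ((6 + t) * (5 + t))
  identity = solve-∀

cube-bound : ∀ {m a n K p} → m ≤ a → m * m ≤ 8 * n ^ 2 * K → a * K ≤ 2 * p → m ^ 3 ≤ 16 * n ^ 2 * p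
cube-bound {m} {a} {n} {K} {p} m≤a m²≤ aK≤2p = begin
  m ^ 3                     ≡⟨ lhs m ⟩
  m * (m * m)               ≤⟨ *-mono-≤ m≤a m²≤ ⟩
  a * (8 * n ^ 2 * K)       ≡⟨ middle a n K ⟩
  8 * n ^ 2 * (a * K)       ≤⟨ *-monoʳ-≤ (8 * n ^ 2) aK≤2p ⟩
  8 * n ^ 2 * (2 * p)       ≡⟨ rhs n p ⟩
  16 * n ^ 2 * p            ∎
  where
  open ≤-Reasoning
  lhs : ∀ m → m * (m * (m * 1)) ≡ m * (m * m)
  lhs = solve-∀
  middle : ∀ a n K → a * (8 * (n * (n * 1)) * K) ≡ 8 * (n * (n * 1)) * (a * K)
  middle = solve-∀
  rhs : ∀ n p → 8 * (n * (n * 1)) * (2 * p) ≡ 16 * (n * (n * 1)) * p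
  rhs = solve-∀

lemma2p2 : (n : ℕ) (G : Graph n) →
    12 * n ≤ edgeCount G →
    edgeCount G ^ 3 ≤ 16 * n ^ 2 * path3Count G
lemma2p2 zero      G _     = z≤n
lemma2p2 n@(suc _) G 12n≤m =
  let T , m≤arcs , minDeg = denseCore G d (m/n*n≤m m (2 * n)) in
  cube-bound {n = n} {p = path3Count G} m≤arcs
    (square-bound n d m 6≤d (<⇒≤ (m<[1+m/n]*n m (2 * n))))
    (≤-trans (arcCount*≤orderedPath3Count G minDeg) (orderedPath3Count≤2*path3Count G))
  where
  m d : ℕ
  m = edgeCount G
  d = m / (2 * n)
  6≤d : 6 ≤ d
  6≤d = subst (_≤ d) (m*n/n≡m 6 (2 * n)) (/-monoˡ-≤ (2 * n) (subst (_≤ m) (twelve n) 12n≤m))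
    where twelve : ∀ n → 12 * n ≡ 6 * (2 * n)
          twelve = solve-∀
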